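{- Let $A'[1\dots n]$ be an integer array. Let $A[1\dots n+1]$ be a maximal function consistent with $A'[1\dots n]$, and let $B[1\dots n+1]$ be any function consistent with $A'[1\dots n]$. Let $i$ be the first position of the last slope of $A$. Then $A[j]=B[j]$ for all $j=1,\dots,i-1$.
   Context: For a word $w$, $\pi_w[j]$ is the length of the longest proper border (word that is both a proper prefix and a proper suffix) of $w[1\dots j]$. For a word $w$ of length $m$, the strong failure function is $\pi'_w[m]=\pi_w[m]$ and, for $j<m$, $\pi'_w[j]$ is the length of the longest proper border $u$ of $w[1\dots j]$ with $w[|u|+1]\neq w[j+1]$, or $-1$ if none exists. An array $A[1\dots n+1]$ is consistent with $A'[1\dots n]$ if there is a word $w$ of length $n+1$ (over some alphabet) with $A[1\dots n+1]=\pi_w[1\dots n+1]$ and $\pi'_w[1\dots n]=A'[1\dots n]$. $A$ is a maximal function consistent with $A'$ if it is consistent with $A'$ and $A[j]\ge B[j]$ for all $j=1,\dots,n+1$ for every $B$ consistent with $A'$. A slope of $A$ is a set of consecutive indices $p,p+1,\dots,p+q$ with $A[p+r]=A[p]+r$ for $r=1,\dots,q$; the indices $1,\dots,n+1$ are partitioned into maximal slopes, and the last slope is the maximal slope containing $n+1$. -}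

module Defs where

open import Data.Nat using (ℕ; zero; suc; _+_; _∸_; _≤_; _<_)
open import Data.Integer as ℤ using (ℤ; +_; -[1+_])
open import Data.Product using (Σ; ∃; _×_; _,_)
open import Data.Sum using (_⊎_)
open import Relation.Binary.PropositionalEquality using (_≡_; _≢_)
open import Relation.Nullary using (¬_)

-- Words and arrays are 1-indexed: a word of length m is a function
-- w : ℕ → ℕ of which only positions 1..m matter (letters coded as naturals);
-- an array X[1..m] is a function X : ℕ → ℤ of which only indices 1..m matter.
Word : Set
Word = ℕ → ℕ

Array : Set
Array = ℕ → ℤ

IsBorder : Word → ℕ → ℕ → Set
IsBorder w j k = k < j × (∀ t → 1 ≤ t → t ≤ k → w t ≡ w ((j ∸ k) + t))

IsPi : Word → ℕ → ℤ → Set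
IsPi w j v = ∃ λ k → v ≡ + k × IsBorder w j k × (∀ k′ → IsBorder w j k′ → k′ ≤ k)

IsStrongPi : Word → ℕ → ℤ → Set
IsStrongPi w j v =
  (∃ λ k → v ≡ + k × IsBorder w j k × w (suc k) ≢ w (suc j)
     × (∀ k′ → IsBorder w j k′ → w (suc k′) ≢ w (suc j) → k′ ≤ k))
  ⊎ (v ≡ -[1+ 0 ] × (∀ k′ → IsBorder w j k′ → ¬ (w (suc k′) ≢ w (suc j))))

Consistent : ℕ → Array → Array → Set
Consistent n A A′ = ∃ λ (w : Word) →
  (∀ j → 1 ≤ j → j ≤ suc n → IsPi w j (A j)) ×
  (∀ j → 1 ≤ j → j ≤ n → IsStrongPi w j (A′ j))

MaximalConsistent : ℕ → Array → Array → Set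
MaximalConsistent n A A′ = Consistent n A A′ ×
  (∀ (B : Array) → Consistent n B A′ → ∀ j → 1 ≤ j → j ≤ suc n → B j ℤ.≤ A j)

IsSlope : Array → ℕ → ℕ → Set
IsSlope A p q = ∀ r → 1 ≤ r → r ≤ q → A (p + r) ≡ A p ℤ.+ + r

-- i is the first position of the last slope of A[1..n+1], i.e. of the maximal
-- slope containing n+1: the least p ∈ [1, n+1] such that p..n+1 is a slope.
LastSlopeStart : ℕ → Array → ℕ → Set
LastSlopeStart n A i = 1 ≤ i × i ≤ suc n × IsSlope A i (suc n ∸ i)
  × (∀ p → 1 ≤ p → p ≤ suc n → IsSlope A p (suc n ∸ p) → i ≤ p)

module Submission where

-- Fix 1 ≤ m < i.  Since m lies before the last slope of A,
-- the slope of A starting at m breaks: there is e = m + d ≤ n with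
-- A[e] = A[m] + d but A[e+1] ≠ A[e] + 1.  For the word w_A realising A,
-- π[e+1] ≠ π[e] + 1 means that the longest border of w_A[1..e] does not
-- extend, i.e. it is already a mismatching border, so A'[e] = π'[e] = A[e].
-- For the word w_B realising B we always have π' ≤ π, so A[e] = A'[e] ≤ B[e];
-- and π grows by at most one per step, so B[e] ≤ B[m] + d.  Hence
-- A[m] + d ≤ B[m] + d, i.e. A[m] ≤ B[m], while maximality of A gives
-- B[m] ≤ A[m].

open import Defs
open import Data.Nat using (ℕ; _≤_; _<_)
open import Relation.Binary.PropositionalEquality using (_≡_)

open import Data.Nat as ℕ using (zero; suc; _+_; _∸_; z≤n; s≤s; s≤s⁻¹)
open import Data.Nat.Properties
  using (≤-refl; ≤-reflexive; ≤-trans; ≤-antisym; <⇒≤; <⇒≱; ≤∧≢⇒<;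
         m≤m+n; n≤1+n; m≤n⇒m≤1+n; m<n⇒m<1+n;
         +-comm; +-suc; +-identityʳ; +-monoʳ-≤; +-monoʳ-<; m∸n+n≡m; m+[n∸m]≡n)
open import Data.Integer as ℤ using (ℤ; +_; +≤+; -≤+)
import Data.Integer.Properties as ℤP
open import Data.Product using (∃; _×_; _,_)
open import Data.Sum using (_⊎_; inj₁; inj₂)
open import Data.Empty using (⊥-elim)
open import Relation.Nullary using (yes; no)
open import Relation.Binary.PropositionalEquality using (_≢_; refl; sym; trans; cong; module ≡-Reasoning)

+-cancelʳ-≤ : ∀ k {i j : ℤ} → i ℤ.+ k ℤ.≤ j ℤ.+ k → i ℤ.≤ j
+-cancelʳ-≤ k {i} {j} i+k≤j+k = begin
  i                   ≡⟨ sym (plus-minus i) ⟩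
  i ℤ.+ k ℤ.- k       ≤⟨ ℤP.+-monoˡ-≤ (ℤ.- k) i+k≤j+k ⟩
  j ℤ.+ k ℤ.- k       ≡⟨ plus-minus j ⟩
  j                   ∎
  where
  open ℤP.≤-Reasoning
  plus-minus : ∀ x → x ℤ.+ k ℤ.- k ≡ x
  plus-minus x = trans (ℤP.+-assoc x k (ℤ.- k))
                       (trans (cong (λ y → x ℤ.+ y) (ℤP.+-inverseʳ k)) (ℤP.+-identityʳ x))

border-restrict : ∀ {w j k} → IsBorder w (suc j) (suc k) → IsBorder w j k
border-restrict (s≤s k<j , matches) = k<j , λ t 1≤t t≤k → matches t 1≤t (m≤n⇒m≤1+n t≤k)

border-extend : ∀ {w j k} → IsBorder w j k → w (suc k) ≡ w (suc j) →
  IsBorder w (suc j) (suc k)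
border-extend {w} {j} {k} (k<j , matches) next-agree = s≤s k<j , extended
  where
  last-position : (j ∸ k) + suc k ≡ suc j
  last-position = trans (+-suc (j ∸ k) k) (cong suc (m∸n+n≡m (<⇒≤ k<j)))

  extended : ∀ t → 1 ≤ t → t ≤ suc k → w t ≡ w ((j ∸ k) + t)
  extended t 1≤t t≤1+k with t ℕ.≟ suc k
  ... | yes refl = trans next-agree (cong w (sym last-position))
  ... | no t≢1+k = matches t 1≤t (s≤s⁻¹ (≤∧≢⇒< t≤1+k t≢1+k))

-- π[j+1] ≤ π[j] + 1: the longest border of w[1..j+1] restricts to a border of w[1..j].
pi-step : ∀ {w j u v} → IsPi w j u → IsPi w (suc j) v → v ℤ.≤ u ℤ.+ + 1
pi-step (_ , refl , _ , _) (zero , refl , _ , _) = +≤+ z≤n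
pi-step (x , refl , _ , longest) (suc y , refl , border , _) =
  +≤+ (≤-trans (s≤s (longest y (border-restrict border))) (≤-reflexive (+-comm 1 x)))

-- π'[j] ≤ π[j]: the strong failure value is a border length (or -1).
strong≤pi : ∀ {w j s v} → IsStrongPi w j s → IsPi w j v → s ℤ.≤ v
strong≤pi (inj₁ (k , refl , border , _ , _)) (_ , refl , _ , longest) = +≤+ (longest k border)
strong≤pi (inj₂ (refl , _)) (_ , refl , _ , _) = -≤+

-- If π[j+1] ≠ π[j] + 1 then π'[j] = π[j]: the longest border of w[1..j]
-- cannot be extended (else π[j+1] = π[j] + 1), so it is itself the longest
-- border followed by a mismatching letter.
strong≡pi-at-break : ∀ {w j u v s} → IsPi w j u → IsPi w (suc j) v →
  v ≢ u ℤ.+ + 1 → IsStrongPi w j s → s ≡ u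
strong≡pi-at-break {w} {j} πj@(b , refl , border , longest)
                           πj+1@(c , refl , _ , longest′) no-step strong
  with w (suc b) ℕ.≟ w (suc j)
... | yes agree = ⊥-elim (no-step (ℤP.≤-antisym (pi-step πj πj+1) longest-extends))
  where
  longest-extends : + b ℤ.+ + 1 ℤ.≤ + c
  longest-extends =
    +≤+ (≤-trans (≤-reflexive (+-comm b 1)) (longest′ (suc b) (border-extend border agree)))
... | no differ with strong
...   | inj₁ (k , refl , border-k , _ , longest-mismatch) =
        cong +_ (≤-antisym (longest k border-k) (longest-mismatch b border differ))
...   | inj₂ (_ , no-mismatch) = ⊥-elim (no-mismatch b border differ)

pi-growth : ∀ {w} {X : Array} m d → (∀ j → m ≤ j → j ≤ m + d → IsPi w j (X j)) →
  X (m + d) ℤ.≤ X m ℤ.+ + d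
pi-growth {X = X} m zero π-X =
  ℤP.≤-reflexive (trans (cong X (+-identityʳ m)) (sym (ℤP.+-identityʳ (X m))))
pi-growth {X = X} m (suc d) π-X = begin
  X (m + suc d)          ≡⟨ cong X (+-suc m d) ⟩
  X (suc (m + d))        ≤⟨ pi-step (π-X (m + d) (m≤m+n m d) m+d≤m+1+d)
                                    (π-X (suc (m + d)) (m≤n⇒m≤1+n (m≤m+n m d)) (≤-reflexive (sym (+-suc m d)))) ⟩
  X (m + d) ℤ.+ + 1      ≤⟨ ℤP.+-monoˡ-≤ (+ 1) (pi-growth m d π-X-shorter) ⟩
  X m ℤ.+ + d ℤ.+ + 1    ≡⟨ ℤP.+-assoc (X m) (+ d) (+ 1) ⟩
  X m ℤ.+ + (d + 1)      ≡⟨ cong (λ e → X m ℤ.+ + e) (+-comm d 1) ⟩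
  X m ℤ.+ + suc d        ∎
  where
  open ℤP.≤-Reasoning
  m+d≤m+1+d : m + d ≤ m + suc d
  m+d≤m+1+d = +-monoʳ-≤ m (n≤1+n d)
  π-X-shorter : ∀ j → m ≤ j → j ≤ m + d → IsPi _ j (X j)
  π-X-shorter j m≤j j≤m+d = π-X j m≤j (≤-trans j≤m+d m+d≤m+1+d)

slope-value : ∀ {A p q r} → IsSlope A p q → r ≤ q → A (p + r) ≡ A p ℤ.+ + r
slope-value {A} {p} {r = zero} slope _ = trans (cong A (+-identityʳ p)) (sym (ℤP.+-identityʳ (A p)))
slope-value {r = suc r} slope r≤q = slope (suc r) (s≤s z≤n) r≤q

slope-extend : ∀ {A p q} → IsSlope A p q → A (suc (p + q)) ≡ A (p + q) ℤ.+ + 1 →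
  IsSlope A p (suc q)
slope-extend {A} {p} {q} slope next r 1≤r r≤1+q with r ℕ.≟ suc q
... | no r≢1+q = slope r 1≤r (s≤s⁻¹ (≤∧≢⇒< r≤1+q r≢1+q))
... | yes refl = begin
  A (p + suc q)            ≡⟨ cong A (+-suc p q) ⟩
  A (suc (p + q))          ≡⟨ next ⟩
  A (p + q) ℤ.+ + 1        ≡⟨ cong (ℤ._+ + 1) (slope-value {A} {p} {q} slope ≤-refl) ⟩
  A p ℤ.+ + q ℤ.+ + 1      ≡⟨ ℤP.+-assoc (A p) (+ q) (+ 1) ⟩
  A p ℤ.+ + (q + 1)        ≡⟨ cong (λ e → A p ℤ.+ + e) (+-comm q 1) ⟩
  A p ℤ.+ + suc q          ∎
  where open ≡-Reasoning

SlopeBreak : Array → ℕ → ℕ → Set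
SlopeBreak A p q = ∃ λ d → d < q
  × A (suc (p + d)) ≢ A (p + d) ℤ.+ + 1
  × A (p + d) ≡ A p ℤ.+ + d

slope-or-break : ∀ A p q → IsSlope A p q ⊎ SlopeBreak A p q
slope-or-break A p zero = inj₁ λ { (suc r) _ () }
slope-or-break A p (suc q) with slope-or-break A p q
... | inj₂ (d , d<q , broken , intact) = inj₂ (d , m<n⇒m<1+n d<q , broken , intact)
... | inj₁ slope with A (suc (p + q)) ℤP.≟ A (p + q) ℤ.+ + 1
...   | yes next = inj₁ (slope-extend {A} {p} {q} slope next)
...   | no broken = inj₂ (q , ≤-refl , broken , slope-value {A} {p} {q} slope ≤-refl)

below-break : ∀ {n A′ A B} m d → Consistent n A A′ → Consistent n B A′ →
  1 ≤ m → m + d ≤ n →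
  A (suc (m + d)) ≢ A (m + d) ℤ.+ + 1 → A (m + d) ≡ A m ℤ.+ + d →
  A m ℤ.≤ B m
below-break {n} {A′} {A} {B} m d (_ , πA , πA′) (_ , πB , πB′) 1≤m e≤n broken intact =
  +-cancelʳ-≤ (+ d) (begin
    A m ℤ.+ + d   ≡⟨ sym intact ⟩
    A e           ≡⟨ sym (strong≡pi-at-break (πA e 1≤e e≤1+n) (πA (suc e) (s≤s z≤n) (s≤s e≤n))
                                              broken (πA′ e 1≤e e≤n)) ⟩
    A′ e          ≤⟨ strong≤pi (πB′ e 1≤e e≤n) (πB e 1≤e e≤1+n) ⟩
    B e           ≤⟨ pi-growth m d (λ j m≤j j≤e → πB j (≤-trans 1≤m m≤j) (≤-trans j≤e e≤1+n)) ⟩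
    B m ℤ.+ + d   ∎)
  where
  open ℤP.≤-Reasoning
  e : ℕ
  e = m + d
  1≤e : 1 ≤ e
  1≤e = ≤-trans 1≤m (m≤m+n m d)
  e≤1+n : e ≤ suc n
  e≤1+n = m≤n⇒m≤1+n e≤n

-- Every index before the last slope of the maximal A is followed, within
-- 1..n, by a break of its slope; there A and B agree by below-break and
-- maximality.
lemma6 : (n : ℕ) (A′ A B : Array) (i : ℕ) →
    MaximalConsistent n A A′ → Consistent n B A′ → LastSlopeStart n A i →
    ∀ j → 1 ≤ j → j < i → A j ≡ B j
lemma6 n A′ A B i (consistent-A , maximal) consistent-B (_ , i≤1+n , _ , least) m 1≤m m<i
  with slope-or-break A m (suc n ∸ m)
... | inj₁ slope-to-end = ⊥-elim (<⇒≱ m<i (least m 1≤m (≤-trans (<⇒≤ m<i) i≤1+n) slope-to-end))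
... | inj₂ (d , d<rest , broken , intact) =
  ℤP.≤-antisym (below-break m d consistent-A consistent-B 1≤m e≤n broken intact)
               (maximal B consistent-B m 1≤m m≤1+n)
  where
  m≤1+n : m ≤ suc n
  m≤1+n = ≤-trans (<⇒≤ m<i) i≤1+n
  e≤n : m + d ≤ n
  e≤n = s≤s⁻¹ (≤-trans (+-monoʳ-< m d<rest) (≤-reflexive (m+[n∸m]≡n m≤1+n)))
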